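{- For every integer $k\ge1$, $$S_k(\mathcal{T}_k)-S_k(\overline{\mathcal{T}}_k)=(-1)^{k+1}\,k!\,2^{\binom{k}{2}}.$$ Furthermore, for all integers $k\ge1$ and $j\ge 0$, $$\left|S_{k+j}(\mathcal{T}_k)-S_{k+j}(\overline{\mathcal{T}}_k)\right|\le (k+j)!\,2^{\binom{k+j+1}{2}}.$$
   Context: For a finite (multi)set $A$ of integers, $S_m(A)=\sum_{a\in A}a^m$. For $k\ge1$, $\mathcal{T}_k$ is the set of integers in $\{0,1,\dots,2^k-1\}$ whose binary digit sum is odd, and $\overline{\mathcal{T}}_k$ is the set of integers in $\{0,1,\dots,2^k-1\}$ whose binary digit sum is even. -}

module Defs where

open import Data.Nat using (ℕ; zero; suc; _+_; _*_; _^_; _%_; _/_)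
open import Data.Nat.ListAction using (sum)
open import Data.Nat.Combinatorics using (_C_)
open import Data.Bool using (Bool; true; false; if_then_else_)
open import Data.List using (List; []; _∷_; filter; map; upTo)
open import Data.Nat.Properties using (_≟_)
open import Data.Integer using (ℤ; +_; _-_)
import Data.Integer
open import Relation.Nullary.Decidable using (⌊_⌋; ¬?)

-- binary digit sum s₂(n), defined with fuel (number of bits examined)
digitSumAux : ℕ → ℕ → ℕ
digitSumAux zero    n = 0
digitSumAux (suc f) n = n % 2 + digitSumAux f (n / 2)

-- n < 2^n, so n bits suffice
digitSum : ℕ → ℕ
digitSum n = digitSumAux n n

T : ℕ → List ℕ
T k = filter (λ n → digitSum n % 2 ≟ 1) (upTo (2 ^ k))

Tbar : ℕ → List ℕ
Tbar k = filter (λ n → digitSum n % 2 ≟ 0) (upTo (2 ^ k))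

S : ℕ → List ℕ → ℕ
S m A = sum (map (λ a → a ^ m) A)

D : ℕ → ℕ → ℤ
D m k = + S m (T k) - + S m (Tbar k)

sign : ℕ → ℤ → ℤ
sign zero    x = x
sign (suc n) x = Data.Integer.- sign n x

-- Write ε(n) = (−1)^{s₂(n)} for the Thue–Morse sign and P_k(m) = Σ_{n<2^k} ε(n) nᵐ,
-- so that S_m(𝒯_k) − S_m(𝒯̄_k) = −P_k(m).  Pairing n = 2a with n = 2a+1, using
-- ε(2a) = ε(a), ε(2a+1) = −ε(a) and the binomial expansion of (2a+1)ᵐ gives
--   P_{k+1}(m) = − Σ_{i<m} C(m,i) 2ⁱ P_k(i).
-- By induction on k this recurrence yields P_k(i) = 0 for i < k, then
-- P_k(k) = (−1)^k k! 2^{C(k,2)}, and the bound |P_k(m)| ≤ m! 2^{C(m+1,2)}.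
module Submission where

open import Data.Nat.Base as ℕ using (ℕ; zero; suc)
import Data.Nat.Properties as ℕₚ
open import Data.List.Base using (List; []; _∷_; foldr; map; applyUpTo)
open import Algebra.Bundles using (CommutativeSemiring)
open import Function.Base using (_∘_)
import Relation.Binary.PropositionalEquality as ≡

module FiniteSums {c ℓ} (R : CommutativeSemiring c ℓ) where
  open CommutativeSemiring R
  open import Algebra.Properties.CommutativeSemigroup +-commutativeSemigroup
    using (interchange)
  open import Relation.Binary.Reasoning.Setoid setoid

  Σ : ℕ → (ℕ → Carrier) → Carrier
  Σ zero    f = 0#
  Σ (suc n) f = Σ n f + f n

  Σ-cong : ∀ n {f g : ℕ → Carrier} → (∀ {i} → i ℕ.< n → f i ≈ g i) → Σ n f ≈ Σ n g
  Σ-cong zero    f≈g = refl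
  Σ-cong (suc n) f≈g = +-cong (Σ-cong n (f≈g ∘ ℕₚ.m<n⇒m<1+n)) (f≈g (ℕₚ.n<1+n n))

  Σ-zero : ∀ n → Σ n (λ _ → 0#) ≈ 0#
  Σ-zero zero    = refl
  Σ-zero (suc n) = trans (+-identityʳ _) (Σ-zero n)

  Σ-vanish : ∀ n {f : ℕ → Carrier} → (∀ {i} → i ℕ.< n → f i ≈ 0#) → Σ n f ≈ 0#
  Σ-vanish n f≈0 = trans (Σ-cong n f≈0) (Σ-zero n)

  Σ-front : ∀ n (f : ℕ → Carrier) → Σ (suc n) f ≈ f 0 + Σ n (f ∘ suc)
  Σ-front zero    f = +-comm 0# (f 0)
  Σ-front (suc n) f = begin
    Σ (suc n) f + f (suc n)            ≈⟨ +-congʳ (Σ-front n f) ⟩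
    (f 0 + Σ n (f ∘ suc)) + f (suc n)  ≈⟨ +-assoc (f 0) _ _ ⟩
    f 0 + Σ (suc n) (f ∘ suc)          ∎

  Σ-+ : ∀ n (f g : ℕ → Carrier) → Σ n (λ i → f i + g i) ≈ Σ n f + Σ n g
  Σ-+ zero    f g = sym (+-identityʳ 0#)
  Σ-+ (suc n) f g = trans (+-congʳ (Σ-+ n f g)) (interchange _ _ _ _)

  Σ-scale : ∀ n x (f : ℕ → Carrier) → Σ n (λ i → x * f i) ≈ x * Σ n f
  Σ-scale zero    x f = sym (zeroʳ x)
  Σ-scale (suc n) x f = trans (+-congʳ (Σ-scale n x f)) (sym (distribˡ x _ _))

  Σ-swap : ∀ n m (F : ℕ → ℕ → Carrier) →
           Σ n (λ a → Σ m (F a)) ≈ Σ m (λ i → Σ n (λ a → F a i))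
  Σ-swap zero    m F = sym (Σ-zero m)
  Σ-swap (suc n) m F =
    trans (+-congʳ (Σ-swap n m F)) (sym (Σ-+ m (λ i → Σ n (λ a → F a i)) (F n)))

  Σ-pairs : ∀ N (g : ℕ → Carrier) →
            Σ (2 ℕ.* N) g ≈ Σ N (λ a → g (2 ℕ.* a) + g (suc (2 ℕ.* a)))
  Σ-pairs zero    g = refl
  Σ-pairs (suc N) g = begin
    Σ (2 ℕ.* suc N) g                   ≡⟨ ≡.cong (λ n → Σ n g) (ℕₚ.*-suc 2 N) ⟩
    (Σ (2 ℕ.* N) g + g (2 ℕ.* N)) + g (suc (2 ℕ.* N))
      ≈⟨ +-assoc _ _ _ ⟩
    Σ (2 ℕ.* N) g + (g (2 ℕ.* N) + g (suc (2 ℕ.* N)))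
      ≈⟨ +-congʳ (Σ-pairs N g) ⟩
    Σ (suc N) (λ a → g (2 ℕ.* a) + g (suc (2 ℕ.* a)))  ∎

  Σ-applyUpTo : ∀ n (g : ℕ → Carrier) (f : ℕ → ℕ) →
                foldr _+_ 0# (map g (applyUpTo f n)) ≈ Σ n (g ∘ f)
  Σ-applyUpTo zero    g f = refl
  Σ-applyUpTo (suc n) g f =
    trans (+-congˡ (Σ-applyUpTo n g (f ∘ suc))) (sym (Σ-front n (g ∘ f)))

open import Defs
open import Data.Nat using (ℕ; _!; _≥_; _≤_; _<_; _+_; _*_; _^_; _%_; _/_; _∸_; z≤n; s≤s)
open import Data.Nat.Properties
open import Data.Nat.DivMod
open import Data.Nat.Divisibility using (∣-refl)
open import Data.Nat.Combinatorics
  using (_C_; nCn≡1; nC1≡n; nCk≡nC[n∸k]; nCk≡n!/k![n-k]!; k![n∸k]!∣n!; k>n⇒nCk≡0;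
         nCk+nC[k+1]≡[n+1]C[k+1])
open import Data.Integer as ℤ using (ℤ; +_; -_; ∣_∣)
import Data.Integer.Properties as ℤₚ
open import Data.Integer.Tactic.RingSolver using (solve-∀)
import Data.Nat.Tactic.RingSolver as ℕRing
open import Data.List.Base using (filter; upTo)
open import Data.Product using (_×_; _,_)
open import Relation.Binary.PropositionalEquality
  using (_≡_; refl; sym; trans; cong; cong₂; subst; module ≡-Reasoning)

open import Algebra.Properties.CommutativeSemigroup *-commutativeSemigroup
  using () renaming (interchange to *-interchange)

module ℕΣ = FiniteSums +-*-commutativeSemiring
module ℤΣ = FiniteSums ℤₚ.+-*-commutativeSemiring

Σ-mono : ∀ n {f g : ℕ → ℕ} → (∀ {i} → i < n → f i ≤ g i) → ℕΣ.Σ n f ≤ ℕΣ.Σ n g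
Σ-mono zero    f≤g = z≤n
Σ-mono (suc n) f≤g = +-mono-≤ (Σ-mono n (f≤g ∘ m<n⇒m<1+n)) (f≤g (n<1+n n))

pos-Σ : ∀ n (f : ℕ → ℕ) → + ℕΣ.Σ n f ≡ ℤΣ.Σ n (+_ ∘ f)
pos-Σ zero    f = refl
pos-Σ (suc n) f = trans (ℤₚ.pos-+ (ℕΣ.Σ n f) (f n)) (cong (ℤ._+ + f n) (pos-Σ n f))

∣Σ∣≤Σ∣∣ : ∀ n (f : ℕ → ℤ) → ∣ ℤΣ.Σ n f ∣ ≤ ℕΣ.Σ n (∣_∣ ∘ f)
∣Σ∣≤Σ∣∣ zero    f = z≤n
∣Σ∣≤Σ∣∣ (suc n) f =
  ≤-trans (ℤₚ.∣i+j∣≤∣i∣+∣j∣ (ℤΣ.Σ n f) (f n)) (+-monoˡ-≤ ∣ f n ∣ (∣Σ∣≤Σ∣∣ n f))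

Σ-neg : ∀ n (f : ℕ → ℤ) → ℤΣ.Σ n (-_ ∘ f) ≡ - ℤΣ.Σ n f
Σ-neg zero    f = refl
Σ-neg (suc n) f =
  trans (cong (ℤ._+ - f n) (Σ-neg n f)) (sym (ℤₚ.neg-distrib-+ (ℤΣ.Σ n f) (f n)))

digitSumAux-zero : ∀ f → digitSumAux f 0 ≡ 0
digitSumAux-zero zero    = refl
digitSumAux-zero (suc f) = digitSumAux-zero f

half-≤ : ∀ n f → n ≤ suc f → n / 2 ≤ f
half-≤ zero    f n≤f = z≤n
half-≤ (suc n) f n≤f = ≤-pred (≤-trans (m/n<m (suc n) 2 (s≤s (s≤s z≤n))) n≤f)

digitSumAux-fuel : ∀ f g n → n ≤ f → n ≤ g → digitSumAux f n ≡ digitSumAux g n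
digitSumAux-fuel zero    zero    n       _   _   = refl
digitSumAux-fuel zero    (suc g) .zero   z≤n _   = sym (digitSumAux-zero g)
digitSumAux-fuel (suc f) zero    .zero   _   z≤n = digitSumAux-zero f
digitSumAux-fuel (suc f) (suc g) n       n≤f n≤g =
  cong (_+_ (n % 2)) (digitSumAux-fuel f g (n / 2) (half-≤ n f n≤f) (half-≤ n g n≤g))

digitSum-step : ∀ n → digitSum n ≡ n % 2 + digitSum (n / 2)
digitSum-step zero    = refl
digitSum-step (suc n) = cong (_+_ (suc n % 2))
  (digitSumAux-fuel n (suc n / 2) (suc n / 2) (half-≤ (suc n) n ≤-refl) ≤-refl)

digitSum-bit : ∀ b a → b < 2 → digitSum (b + 2 * a) ≡ b + digitSum a
digitSum-bit b a b<2 = begin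
  digitSum (b + 2 * a)                   ≡⟨ digitSum-step (b + 2 * a) ⟩
  (b + 2 * a) % 2 + digitSum ((b + 2 * a) / 2)
    ≡⟨ cong₂ (λ r q → r + digitSum q) remainder quotient ⟩
  b + digitSum a                         ∎
  where
  open ≡-Reasoning
  b+2a≡b+a*2 : b + 2 * a ≡ b + a * 2
  b+2a≡b+a*2 = cong (_+_ b) (*-comm 2 a)
  remainder : (b + 2 * a) % 2 ≡ b
  remainder = trans (cong (_% 2) b+2a≡b+a*2)
                    (trans ([m+kn]%n≡m%n b a 2) (m<n⇒m%n≡m b<2))
  quotient : (b + 2 * a) / 2 ≡ a
  quotient = begin
    (b + 2 * a) / 2      ≡⟨ cong (_/ 2) b+2a≡b+a*2 ⟩
    (b + a * 2) / 2      ≡⟨ +-distrib-/ b (a * 2) no-carry ⟩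
    b / 2 + a * 2 / 2    ≡⟨ cong₂ _+_ (m<n⇒m/n≡0 b<2) (m*n/n≡m a 2) ⟩
    a                    ∎
    where
    no-carry : b % 2 + a * 2 % 2 < 2
    no-carry = subst (_< 2) (sym (trans (cong₂ _+_ (m<n⇒m%n≡m b<2) (m*n%n≡0 a 2))
                                       (+-identityʳ b))) b<2

sign-parity : ∀ n x → sign n x ≡ sign (n % 2) x
sign-parity zero          x = refl
sign-parity (suc zero)    x = refl
sign-parity (suc (suc n)) x = begin
  - - sign n x     ≡⟨ ℤₚ.neg-involutive (sign n x) ⟩
  sign n x         ≡⟨ sign-parity n x ⟩
  sign (n % 2) x   ≡⟨ cong (λ r → sign r x) (sym (%-remove-+ˡ n (∣-refl {2}))) ⟩
  sign (suc (suc n) % 2) x  ∎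
  where open ≡-Reasoning

sign-scale : ∀ n c x → c ℤ.* sign n x ≡ sign n (c ℤ.* x)
sign-scale zero    c x = refl
sign-scale (suc n) c x =
  trans (sym (ℤₚ.neg-distribʳ-* c (sign n x))) (cong -_ (sign-scale n c x))

ε : ℕ → ℤ
ε n = sign (digitSum n) (+ 1)

ε-parity : ∀ {n r} → digitSum n % 2 ≡ r → ε n ≡ sign r (+ 1)
ε-parity {n} parity = trans (sign-parity (digitSum n) (+ 1)) (cong (λ r → sign r (+ 1)) parity)

ε-double : ∀ a → ε (2 * a) ≡ ε a
ε-double a = cong (λ s → sign s (+ 1)) (digitSum-bit 0 a (s≤s z≤n))

ε-double+1 : ∀ a → ε (suc (2 * a)) ≡ - ε a
ε-double+1 a = cong (λ s → sign s (+ 1)) (digitSum-bit 1 a (s≤s (s≤s z≤n)))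

P : ℕ → ℕ → ℤ
P k m = ℤΣ.Σ (2 ^ k) (λ n → ε n ℤ.* + (n ^ m))

-- Moving one element into the even part, resp. the odd part, of a list.
even-step : ∀ a A₁ A₀ L s → s ≡ + 1 → + A₁ ℤ.- + A₀ ≡ - L →
            + A₁ ℤ.- + (a + A₀) ≡ - (s ℤ.* + a ℤ.+ L)
even-step a A₁ A₀ L .(+ 1) refl difference = begin
  + A₁ ℤ.- + (a + A₀)          ≡⟨ cong (λ z → + A₁ ℤ.- z) (ℤₚ.pos-+ a A₀) ⟩
  + A₁ ℤ.- (+ a ℤ.+ + A₀)      ≡⟨ regroup (+ a) (+ A₁) (+ A₀) ⟩
  - + a ℤ.+ (+ A₁ ℤ.- + A₀)    ≡⟨ cong (ℤ._+_ (- + a)) difference ⟩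
  - + a ℤ.+ - L                ≡⟨ collect (+ a) L ⟩
  - (+ 1 ℤ.* + a ℤ.+ L)        ∎
  where
  open ≡-Reasoning
  regroup : ∀ x y z → y ℤ.- (x ℤ.+ z) ≡ - x ℤ.+ (y ℤ.- z)
  regroup = solve-∀
  collect : ∀ x l → - x ℤ.+ - l ≡ - (+ 1 ℤ.* x ℤ.+ l)
  collect = solve-∀

odd-step : ∀ a A₁ A₀ L s → s ≡ - + 1 → + A₁ ℤ.- + A₀ ≡ - L →
           + (a + A₁) ℤ.- + A₀ ≡ - (s ℤ.* + a ℤ.+ L)
odd-step a A₁ A₀ L .(- + 1) refl difference = begin
  + (a + A₁) ℤ.- + A₀          ≡⟨ cong (ℤ._- + A₀) (ℤₚ.pos-+ a A₁) ⟩
  (+ a ℤ.+ + A₁) ℤ.- + A₀      ≡⟨ regroup (+ a) (+ A₁) (+ A₀) ⟩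
  + a ℤ.+ (+ A₁ ℤ.- + A₀)      ≡⟨ cong (ℤ._+_ (+ a)) difference ⟩
  + a ℤ.+ - L                  ≡⟨ collect (+ a) L ⟩
  - (- + 1 ℤ.* + a ℤ.+ L)      ∎
  where
  open ≡-Reasoning
  regroup : ∀ x y z → (x ℤ.+ y) ℤ.- z ≡ x ℤ.+ (y ℤ.- z)
  regroup = solve-∀
  collect : ∀ x l → x ℤ.+ - l ≡ - (- + 1 ℤ.* x ℤ.+ l)
  collect = solve-∀

odd-part even-part : ℕ → List ℕ → ℕ
odd-part  m xs = S m (filter (λ n → digitSum n % 2 ≟ 1) xs)
even-part m xs = S m (filter (λ n → digitSum n % 2 ≟ 0) xs)

parity-difference : ∀ m xs →
  + odd-part m xs ℤ.- + even-part m xs ≡ - foldr ℤ._+_ (+ 0) (map (λ n → ε n ℤ.* + (n ^ m)) xs)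
parity-difference m [] = refl
parity-difference m (x ∷ xs) with digitSum x % 2 in parity | m%n<n (digitSum x) 2
... | 0           | _ = even-step (x ^ m) (odd-part m xs) (even-part m xs) _ _
                            (ε-parity {x} parity) (parity-difference m xs)
... | 1           | _ = odd-step  (x ^ m) (odd-part m xs) (even-part m xs) _ _
                            (ε-parity {x} parity) (parity-difference m xs)
... | suc (suc _) | s≤s (s≤s ())

difference-is-signed-sum : ∀ m k → D m k ≡ - P k m
difference-is-signed-sum m k =
  trans (parity-difference m (upTo (2 ^ k)))
        (cong -_ (ℤΣ.Σ-applyUpTo (2 ^ k) (λ n → ε n ℤ.* + (n ^ m)) (λ n → n)))

binomial : ∀ m x → suc x ^ m ≡ ℕΣ.Σ (suc m) (λ i → (m C i) * x ^ i)
binomial zero    x = refl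
binomial (suc m) x = begin
  suc x ^ suc m                          ≡⟨ expand x (suc x ^ m) ⟩
  x * suc x ^ m + (suc x ^ m + 0)        ≡⟨ cong (λ y → x * y + (y + 0)) (binomial m x) ⟩
  x * Bₘ + (Bₘ + 0)                      ≡⟨ cong (λ c → x * Bₘ + (Bₘ + c * x ^ suc m)) top-vanishes ⟨
  x * Bₘ + ℕΣ.Σ (suc (suc m)) (λ i → (m C i) * x ^ i)
    ≡⟨ cong (_+_ (x * Bₘ)) (ℕΣ.Σ-front (suc m) (λ i → (m C i) * x ^ i)) ⟩
  x * Bₘ + (1 + Sh)                      ≡⟨ shuffle (x * Bₘ) Sh ⟩
  1 + (x * Bₘ + Sh)
    ≡⟨ cong (λ y → 1 + (y + Sh)) (ℕΣ.Σ-scale (suc m) x (λ i → (m C i) * x ^ i)) ⟨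
  1 + (ℕΣ.Σ (suc m) (λ i → x * ((m C i) * x ^ i)) + Sh)
    ≡⟨ cong (_+_ 1) (ℕΣ.Σ-+ (suc m) (λ i → x * ((m C i) * x ^ i)) (λ i → (m C suc i) * x ^ suc i)) ⟨
  1 + ℕΣ.Σ (suc m) (λ i → x * ((m C i) * x ^ i) + (m C suc i) * x ^ suc i)
    ≡⟨ cong (_+_ 1) (ℕΣ.Σ-cong (suc m) (λ {i} _ → pascal-term i)) ⟩
  1 + ℕΣ.Σ (suc m) (λ i → (suc m C suc i) * x ^ suc i)
    ≡⟨ ℕΣ.Σ-front (suc m) (λ i → (suc m C i) * x ^ i) ⟨
  ℕΣ.Σ (suc (suc m)) (λ i → (suc m C i) * x ^ i)  ∎
  where
  open ≡-Reasoning
  Bₘ Sh : ℕ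
  Bₘ = ℕΣ.Σ (suc m) (λ i → (m C i) * x ^ i)
  Sh = ℕΣ.Σ (suc m) (λ i → (m C suc i) * x ^ suc i)
  top-vanishes : m C suc m ≡ 0
  top-vanishes = k>n⇒nCk≡0 (n<1+n m)
  expand : ∀ a y → (1 + a) * y ≡ a * y + (y + 0)
  expand = ℕRing.solve-∀
  shuffle : ∀ y t → y + (1 + t) ≡ 1 + (y + t)
  shuffle = ℕRing.solve-∀
  pascal-term : ∀ i → x * ((m C i) * x ^ i) + (m C suc i) * x ^ suc i
                    ≡ (suc m C suc i) * x ^ suc i
  pascal-term i = begin
    x * ((m C i) * x ^ i) + (m C suc i) * (x * x ^ i)  ≡⟨ collect (m C i) (m C suc i) x (x ^ i) ⟩
    (m C i + m C suc i) * (x * x ^ i)                  ≡⟨ cong (_* x ^ suc i) (nCk+nC[k+1]≡[n+1]C[k+1] m i) ⟩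
    (suc m C suc i) * x ^ suc i                        ∎
    where
    collect : ∀ a b y z → y * (a * z) + b * (y * z) ≡ (a + b) * (y * z)
    collect = ℕRing.solve-∀

binomial-top : ∀ m x → suc x ^ m ≡ ℕΣ.Σ m (λ i → (m C i) * x ^ i) + x ^ m
binomial-top m x =
  trans (binomial m x)
        (cong (_+_ (ℕΣ.Σ m (λ i → (m C i) * x ^ i))) (trans (cong (_* x ^ m) (nCn≡1 m)) (*-identityˡ (x ^ m))))

power-of-product : ∀ x y n → (x * y) ^ n ≡ x ^ n * y ^ n
power-of-product x y zero    = refl
power-of-product x y (suc n) =
  trans (cong ((x * y) *_) (power-of-product x y n)) (*-interchange x y (x ^ n) (y ^ n))

pair-contribution : ∀ m a →
  ε (2 * a) ℤ.* + ((2 * a) ^ m) ℤ.+ ε (suc (2 * a)) ℤ.* + (suc (2 * a) ^ m)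
  ≡ - ℤΣ.Σ m (λ i → + ((m C i) * 2 ^ i) ℤ.* (ε a ℤ.* + (a ^ i)))
pair-contribution m a = begin
  ε (2 * a) ℤ.* Y ℤ.+ ε (suc (2 * a)) ℤ.* + (suc (2 * a) ^ m)
    ≡⟨ cong₂ (λ u v → u ℤ.* Y ℤ.+ v ℤ.* + (suc (2 * a) ^ m)) (ε-double a) (ε-double+1 a) ⟩
  ε a ℤ.* Y ℤ.+ - ε a ℤ.* + (suc (2 * a) ^ m)
    ≡⟨ cong (λ z → ε a ℤ.* Y ℤ.+ - ε a ℤ.* z) expand-odd ⟩
  ε a ℤ.* Y ℤ.+ - ε a ℤ.* (+ Q ℤ.+ Y)     ≡⟨ cancel (ε a) Y (+ Q) ⟩
  - (ε a ℤ.* + Q)                         ≡⟨ cong (λ z → - (ε a ℤ.* z)) (pos-Σ m (λ i → (m C i) * (2 * a) ^ i)) ⟩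
  - (ε a ℤ.* ℤΣ.Σ m (λ i → + ((m C i) * (2 * a) ^ i)))
    ≡⟨ cong -_ (ℤΣ.Σ-scale m (ε a) (λ i → + ((m C i) * (2 * a) ^ i))) ⟨
  - ℤΣ.Σ m (λ i → ε a ℤ.* + ((m C i) * (2 * a) ^ i))
    ≡⟨ cong -_ (ℤΣ.Σ-cong m (λ {i} _ → reweigh i)) ⟩
  - ℤΣ.Σ m (λ i → + ((m C i) * 2 ^ i) ℤ.* (ε a ℤ.* + (a ^ i)))  ∎
  where
  open ≡-Reasoning
  Y : ℤ
  Y = + ((2 * a) ^ m)
  Q : ℕ
  Q = ℕΣ.Σ m (λ i → (m C i) * (2 * a) ^ i)
  expand-odd : + (suc (2 * a) ^ m) ≡ + Q ℤ.+ Y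
  expand-odd = trans (cong +_ (binomial-top m (2 * a))) (ℤₚ.pos-+ Q ((2 * a) ^ m))
  cancel : ∀ e y q → e ℤ.* y ℤ.+ - e ℤ.* (q ℤ.+ y) ≡ - (e ℤ.* q)
  cancel = solve-∀
  reweigh : ∀ i → ε a ℤ.* + ((m C i) * (2 * a) ^ i) ≡ + ((m C i) * 2 ^ i) ℤ.* (ε a ℤ.* + (a ^ i))
  reweigh i = begin
    ε a ℤ.* + ((m C i) * (2 * a) ^ i)
      ≡⟨ cong (λ z → ε a ℤ.* + ((m C i) * z)) (power-of-product 2 a i) ⟩
    ε a ℤ.* + ((m C i) * (2 ^ i * a ^ i))
      ≡⟨ cong (ε a ℤ.*_) (trans (ℤₚ.pos-* (m C i) _) (cong (+ (m C i) ℤ.*_) (ℤₚ.pos-* (2 ^ i) (a ^ i)))) ⟩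
    ε a ℤ.* (+ (m C i) ℤ.* (+ (2 ^ i) ℤ.* + (a ^ i)))
      ≡⟨ regroup (ε a) (+ (m C i)) (+ (2 ^ i)) (+ (a ^ i)) ⟩
    (+ (m C i) ℤ.* + (2 ^ i)) ℤ.* (ε a ℤ.* + (a ^ i))
      ≡⟨ cong (ℤ._* (ε a ℤ.* + (a ^ i))) (ℤₚ.pos-* (m C i) (2 ^ i)) ⟨
    + ((m C i) * 2 ^ i) ℤ.* (ε a ℤ.* + (a ^ i))  ∎
    where
    regroup : ∀ e c t u → e ℤ.* (c ℤ.* (t ℤ.* u)) ≡ (c ℤ.* t) ℤ.* (e ℤ.* u)
    regroup = solve-∀

recurrence : ∀ k m → P (suc k) m ≡ - ℤΣ.Σ m (λ i → + ((m C i) * 2 ^ i) ℤ.* P k i)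
recurrence k m = begin
  P (suc k) m                                          ≡⟨ ℤΣ.Σ-pairs (2 ^ k) term ⟩
  ℤΣ.Σ (2 ^ k) (λ a → term (2 * a) ℤ.+ term (suc (2 * a)))
    ≡⟨ ℤΣ.Σ-cong (2 ^ k) (λ {a} _ → pair-contribution m a) ⟩
  ℤΣ.Σ (2 ^ k) (λ a → - ℤΣ.Σ m (F a))                  ≡⟨ Σ-neg (2 ^ k) (λ a → ℤΣ.Σ m (F a)) ⟩
  - ℤΣ.Σ (2 ^ k) (λ a → ℤΣ.Σ m (F a))                  ≡⟨ cong -_ (ℤΣ.Σ-swap (2 ^ k) m F) ⟩
  - ℤΣ.Σ m (λ i → ℤΣ.Σ (2 ^ k) (λ a → F a i))
    ≡⟨ cong -_ (ℤΣ.Σ-cong m (λ {i} _ → ℤΣ.Σ-scale (2 ^ k) (+ ((m C i) * 2 ^ i)) (λ a → term′ i a))) ⟩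
  - ℤΣ.Σ m (λ i → + ((m C i) * 2 ^ i) ℤ.* P k i)         ∎
  where
  open ≡-Reasoning
  term : ℕ → ℤ
  term n = ε n ℤ.* + (n ^ m)
  term′ : ℕ → ℕ → ℤ
  term′ i a = ε a ℤ.* + (a ^ i)
  F : ℕ → ℕ → ℤ
  F a i = + ((m C i) * 2 ^ i) ℤ.* term′ i a

P-zero : ∀ m → P 0 m ≡ + (0 ^ m)
P-zero m = trans (ℤₚ.+-identityˡ _) (ℤₚ.*-identityˡ _)

vanishing : ∀ k i → i < k → P k i ≡ + 0
vanishing (suc k) i (s≤s i≤k) = trans (recurrence k i) (cong -_ (ℤΣ.Σ-vanish i lower-terms))
  where
  lower-terms : ∀ {j} → j < i → + ((i C j) * 2 ^ j) ℤ.* P k j ≡ + 0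
  lower-terms {j} j<i =
    trans (cong (+ ((i C j) * 2 ^ j) ℤ.*_) (vanishing k j (<-≤-trans j<i i≤k))) (ℤₚ.*-zeroʳ (+ ((i C j) * 2 ^ j)))

suc-C2 : ∀ n → suc n C 2 ≡ n + n C 2
suc-C2 n = trans (sym (nCk+nC[k+1]≡[n+1]C[k+1] n 1)) (cong (_+ n C 2) (nC1≡n n))

suc-C-self : ∀ k → suc k C k ≡ suc k
suc-C-self k = begin
  suc k C k              ≡⟨ nCk≡nC[n∸k] (n≤1+n k) ⟩
  suc k C (suc k ∸ k)    ≡⟨ cong (suc k C_) (m+n∸n≡m 1 k) ⟩
  suc k C 1              ≡⟨ nC1≡n (suc k) ⟩
  suc k                  ∎
  where open ≡-Reasoning

-- The diagonal value P_k(k) = (−1)^k k! 2^{C(k,2)}: in the recurrence only the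
-- top term i = k survives, with weight C(k+1,k) 2^k = (k+1) 2^k.
diagonal : ∀ k → P k k ≡ sign k (+ (k ! * 2 ^ (k C 2)))
diagonal zero    = refl
diagonal (suc k) = begin
  P (suc k) (suc k)                                    ≡⟨ recurrence k (suc k) ⟩
  - (ℤΣ.Σ k term ℤ.+ term k)                           ≡⟨ cong (λ z → - (z ℤ.+ term k)) lower-terms ⟩
  - (+ 0 ℤ.+ term k)                                   ≡⟨ cong -_ (ℤₚ.+-identityˡ (term k)) ⟩
  - (+ ((suc k C k) * 2 ^ k) ℤ.* P k k)
    ≡⟨ cong₂ (λ c p → - (+ (c * 2 ^ k) ℤ.* p)) (suc-C-self k) (diagonal k) ⟩
  - (+ (suc k * 2 ^ k) ℤ.* sign k (+ (k ! * 2 ^ (k C 2))))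
    ≡⟨ cong -_ (sign-scale k (+ (suc k * 2 ^ k)) (+ (k ! * 2 ^ (k C 2)))) ⟩
  - sign k (+ (suc k * 2 ^ k) ℤ.* + (k ! * 2 ^ (k C 2)))
    ≡⟨ cong (λ z → - sign k z) (trans (sym (ℤₚ.pos-* (suc k * 2 ^ k) _)) (cong +_ factorial-step)) ⟩
  - sign k (+ (suc k ! * 2 ^ (suc k C 2)))             ∎
  where
  open ≡-Reasoning
  term : ℕ → ℤ
  term i = + ((suc k C i) * 2 ^ i) ℤ.* P k i
  lower-terms : ℤΣ.Σ k term ≡ + 0
  lower-terms = ℤΣ.Σ-vanish k (λ {i} i<k →
    trans (cong (+ ((suc k C i) * 2 ^ i) ℤ.*_) (vanishing k i i<k)) (ℤₚ.*-zeroʳ (+ ((suc k C i) * 2 ^ i))))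
  factorial-step : (suc k * 2 ^ k) * (k ! * 2 ^ (k C 2)) ≡ suc k ! * 2 ^ (suc k C 2)
  factorial-step = begin
    (suc k * 2 ^ k) * (k ! * 2 ^ (k C 2))   ≡⟨ *-interchange (suc k) (2 ^ k) (k !) _ ⟩
    suc k ! * (2 ^ k * 2 ^ (k C 2))         ≡⟨ cong (suc k ! *_) (^-distribˡ-+-* 2 k (k C 2)) ⟨
    suc k ! * 2 ^ (k + k C 2)               ≡⟨ cong (λ e → suc k ! * 2 ^ e) (suc-C2 k) ⟨
    suc k ! * 2 ^ (suc k C 2)               ∎

-- C(m,i) i! ≤ m! for i ≤ m, because C(m,i) i! (m−i)! = m!.
binomial-factorial : ∀ {m i} → i ≤ m → (m C i) * i ! ≤ m !
binomial-factorial {m} {i} i≤m = begin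
  (m C i) * i !                                   ≤⟨ m≤m*n ((m C i) * i !) ((m ∸ i) !) ⟩
  (m C i) * i ! * (m ∸ i) !                       ≡⟨ *-assoc (m C i) (i !) ((m ∸ i) !) ⟩
  (m C i) * (i ! * (m ∸ i) !)                     ≡⟨ cong (_* (i ! * (m ∸ i) !)) (nCk≡n!/k![n-k]! i≤m) ⟩
  (m ! / (i ! * (m ∸ i) !)) * (i ! * (m ∸ i) !)   ≡⟨ m/n*n≡m (k![n∸k]!∣n! i≤m) ⟩
  m !                                             ∎
  where
  open ≤-Reasoning
  instance
    _ = (m ∸ i) !≢0
    _ = i !* (m ∸ i) !≢0

-- Σ_{i<m} 2ⁱ 2^{C(i+1,2)} ≤ 2^{C(m+1,2)}: each new term at most doubles the bound,
-- since 2^{C(m+2,2)} = 2^{m+1} 2^{C(m+1,2)}.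
geometric : ∀ m → ℕΣ.Σ m (λ i → 2 ^ i * 2 ^ (suc i C 2)) ≤ 2 ^ (suc m C 2)
geometric zero    = z≤n
geometric (suc m) = begin
  ℕΣ.Σ m (λ i → 2 ^ i * 2 ^ (suc i C 2)) + 2 ^ m * X  ≤⟨ +-monoˡ-≤ (2 ^ m * X) (geometric m) ⟩
  X + 2 ^ m * X                                      ≤⟨ +-monoˡ-≤ (2 ^ m * X) (m≤n*m X (2 ^ m)) ⟩
  2 ^ m * X + 2 ^ m * X                              ≡⟨ doubling (2 ^ m) X ⟩
  2 ^ suc m * X                                      ≡⟨ ^-distribˡ-+-* 2 (suc m) (suc m C 2) ⟨
  2 ^ (suc m + suc m C 2)                            ≡⟨ cong (2 ^_) (suc-C2 (suc m)) ⟨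
  2 ^ (suc (suc m) C 2)                              ∎
  where
  open ≤-Reasoning
  X : ℕ
  X = 2 ^ (suc m C 2)
  instance
    _ = m^n≢0 2 m
  doubling : ∀ y x → y * x + y * x ≡ (2 * y) * x
  doubling = ℕRing.solve-∀

bound : ∀ k m → ∣ P k m ∣ ≤ m ! * 2 ^ (suc m C 2)
bound zero    m = begin
  ∣ P 0 m ∣                  ≡⟨ cong ∣_∣ (P-zero m) ⟩
  0 ^ m                      ≤⟨ ^-monoˡ-≤ m z≤n ⟩
  1 ^ m                      ≡⟨ ^-zeroˡ m ⟩
  1 * 1                      ≤⟨ *-mono-≤ (1≤n! m) (m^n>0 2 (suc m C 2)) ⟩
  m ! * 2 ^ (suc m C 2)      ∎
  where open ≤-Reasoning
bound (suc k) m = begin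
  ∣ P (suc k) m ∣                                   ≡⟨ cong ∣_∣ (recurrence k m) ⟩
  ∣ - ℤΣ.Σ m term ∣                                 ≡⟨ ℤₚ.∣-i∣≡∣i∣ (ℤΣ.Σ m term) ⟩
  ∣ ℤΣ.Σ m term ∣                                   ≤⟨ ∣Σ∣≤Σ∣∣ m term ⟩
  ℕΣ.Σ m (∣_∣ ∘ term)                               ≤⟨ Σ-mono m term-bound ⟩
  ℕΣ.Σ m (λ i → m ! * (2 ^ i * 2 ^ (suc i C 2)))   ≡⟨ ℕΣ.Σ-scale m (m !) (λ i → 2 ^ i * 2 ^ (suc i C 2)) ⟩
  m ! * ℕΣ.Σ m (λ i → 2 ^ i * 2 ^ (suc i C 2))     ≤⟨ *-monoʳ-≤ (m !) (geometric m) ⟩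
  m ! * 2 ^ (suc m C 2)                             ∎
  where
  open ≤-Reasoning
  term : ℕ → ℤ
  term i = + ((m C i) * 2 ^ i) ℤ.* P k i
  term-bound : ∀ {i} → i < m → ∣ term i ∣ ≤ m ! * (2 ^ i * 2 ^ (suc i C 2))
  term-bound {i} i<m = begin
    ∣ term i ∣                                     ≡⟨ ℤₚ.abs-* (+ ((m C i) * 2 ^ i)) (P k i) ⟩
    ((m C i) * 2 ^ i) * ∣ P k i ∣                  ≤⟨ *-monoʳ-≤ ((m C i) * 2 ^ i) (bound k i) ⟩
    ((m C i) * 2 ^ i) * (i ! * 2 ^ (suc i C 2))    ≡⟨ *-interchange (m C i) (2 ^ i) (i !) _ ⟩
    ((m C i) * i !) * (2 ^ i * 2 ^ (suc i C 2))    ≤⟨ *-monoˡ-≤ _ (binomial-factorial (<⇒≤ i<m)) ⟩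
    m ! * (2 ^ i * 2 ^ (suc i C 2))                ∎

mainTheorem8 : (∀ (k : ℕ) → k ≥ 1 →
                 D k k ≡ sign (k + 1) (+ ((k !) * 2 ^ (k C 2))))
             × (∀ (k j : ℕ) → k ≥ 1 →
                 ∣ D (k + j) k ∣ ≤ ((k + j) !) * 2 ^ ((k + j + 1) C 2))
mainTheorem8 = (λ k _ → diagonal-difference k) , (λ k j _ → bounded-difference k j)
  where
  diagonal-difference : ∀ k → D k k ≡ sign (k + 1) (+ ((k !) * 2 ^ (k C 2)))
  diagonal-difference k = begin
    D k k                                  ≡⟨ difference-is-signed-sum k k ⟩
    - P k k                                ≡⟨ cong -_ (diagonal k) ⟩
    sign (1 + k) (+ (k ! * 2 ^ (k C 2)))   ≡⟨ cong (λ n → sign n (+ (k ! * 2 ^ (k C 2)))) (+-comm 1 k) ⟩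
    sign (k + 1) (+ (k ! * 2 ^ (k C 2)))   ∎
    where open ≡-Reasoning
  bounded-difference : ∀ k j → ∣ D (k + j) k ∣ ≤ ((k + j) !) * 2 ^ ((k + j + 1) C 2)
  bounded-difference k j = begin
    ∣ D (k + j) k ∣                        ≡⟨ cong ∣_∣ (difference-is-signed-sum (k + j) k) ⟩
    ∣ - P k (k + j) ∣                      ≡⟨ ℤₚ.∣-i∣≡∣i∣ (P k (k + j)) ⟩
    ∣ P k (k + j) ∣                        ≤⟨ bound k (k + j) ⟩
    (k + j) ! * 2 ^ ((1 + (k + j)) C 2)    ≡⟨ cong (λ n → (k + j) ! * 2 ^ (n C 2)) (+-comm 1 (k + j)) ⟩
    (k + j) ! * 2 ^ ((k + j + 1) C 2)      ∎
    where open ≤-Reasoning
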